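{- Let $G$ be a finite group, $S\subseteq G$ with $1_G\notin S$ and $S=S^{ -1}$, and let $1_G\neq s\in S$. Then the left cosets of $\langle s\rangle$ in $G$ form an invariant partition (block system) of the group ${\mathcal A}^o$ of color-preserving automorphisms of ${\rm Cay}(G,S)$. Consequently, if there is some $s\in S$ with $\langle s\rangle\neq G$ and $\langle s\rangle \ne \{1_G\}$, then ${\mathcal A}^o$ is imprimitive.
   Context: The Cayley graph ${\rm Cay}(G,S)$ has vertex set $G$ and edges $\{g,gs\}$ for $g\in G$, $s\in S$. Each edge $\{g,gs\}$ is colored by the color $c(s)$, where $c(s)=c(s')$ iff $s'\in\{s,s^{ -1}\}$. An automorphism is color-preserving if it maps each color class of edges onto itself; ${\mathcal A}^o$ denotes the group of all color-preserving automorphisms. An invariant partition of a permutation group $H$ on $X$ is a partition of $X$ such that every element of $H$ maps each part onto a part. -}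

module Defs where

open import Level using (Level; _⊔_; suc)
open import Algebra.Bundles using (Group)
open import Data.Nat using (ℕ; zero) renaming (suc to sucℕ)
open import Data.Integer using (ℤ; +_; -[1+_])
open import Data.List using (List)
open import Data.List.Membership.Setoid using ()
open import Data.List.Relation.Unary.Any using (Any)
open import Data.Product using (Σ; ∃; _×_; _,_)
open import Data.Sum using (_⊎_)
open import Relation.Nullary using (¬_)
open import Relation.Binary using (Decidable)
open import Function.Bundles using (Bijection; _⇔_)

module _ {c ℓ : Level} (G : Group c ℓ) where
  open Group G

  IsFiniteGroup : Set (c ⊔ ℓ)
  IsFiniteGroup = Decidable _≈_ × (Σ (List Carrier) λ xs → ∀ x → Any (x ≈_) xs)

  powℕ : Carrier → ℕ → Carrier
  powℕ x zero     = ε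
  powℕ x (sucℕ n) = x ∙ powℕ x n

  powℤ : Carrier → ℤ → Carrier
  powℤ x (+ n)    = powℕ x n
  powℤ x -[1+ n ] = (powℕ x (sucℕ n)) ⁻¹

  ⟨_⟩ : Carrier → Carrier → Set ℓ
  ⟨ s ⟩ g = ∃ λ (k : ℤ) → g ≈ powℤ s k

  LeftCoset : Carrier → Carrier → Carrier → Set ℓ
  LeftCoset s x z = ∃ λ (k : ℤ) → z ≈ x ∙ powℤ s k

  -- {x,y} is an edge of Cay(G,S) of color c(s) = {s, s⁻¹}
  -- (i.e. {x,y} = {g, g s} or {g, g s⁻¹} for some g)
  EdgeOfColor : Carrier → Carrier → Carrier → Set ℓ
  EdgeOfColor s x y = (y ≈ x ∙ s) ⊎ (y ≈ x ∙ (s ⁻¹))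

  Perm : Set (c ⊔ ℓ)
  Perm = Bijection setoid setoid

  IsColorPreservingAut : {ℓS : Level} → (Carrier → Set ℓS) → Perm → Set (c ⊔ ℓ ⊔ ℓS)
  IsColorPreservingAut S φ =
    ∀ s → S s → ∀ x y → EdgeOfColor s x y ⇔ EdgeOfColor s (to x) (to y)
    where open Bijection φ

  MapsOnto : {ℓP ℓQ : Level} → Perm → (Carrier → Set ℓP) → (Carrier → Set ℓQ) → Set (c ⊔ ℓ ⊔ ℓP ⊔ ℓQ)
  MapsOnto φ P Q = (∀ z → P z → Q (to z)) × (∀ w → Q w → ∃ λ z → P z × to z ≈ w)
    where open Bijection φ

  IsPartition : {ℓI ℓP : Level} {I : Set ℓI} → (I → Carrier → Set ℓP) → Set (c ⊔ ℓI ⊔ ℓP)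
  IsPartition {I = I} P =
    (∀ i → ∃ λ z → P i z)
    × (∀ x → ∃ λ i → P i x)
    × (∀ i j → (∃ λ z → P i z × P j z) → ∀ z → (P i z → P j z) × (P j z → P i z))

  IsInvariantPartition : {ℓH ℓI ℓP : Level} {I : Set ℓI} → (Perm → Set ℓH) → (I → Carrier → Set ℓP) → Set (c ⊔ ℓ ⊔ ℓH ⊔ ℓI ⊔ ℓP)
  IsInvariantPartition {I = I} H P =
    IsPartition P × (∀ φ → H φ → ∀ i → ∃ λ j → MapsOnto φ (P i) (P j))

  -- a permutation group H is imprimitive: it has a nontrivial invariant
  -- partition (some part has two distinct elements and there are at least
  -- two parts)
  IsImprimitive : {ℓH : Level} → (Perm → Set ℓH) → Set (suc (c ⊔ ℓ) ⊔ ℓH)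
  IsImprimitive H =
    ∃ λ (P : Carrier → Carrier → Set (c ⊔ ℓ)) →
      IsInvariantPartition H P
      × (∃ λ i → ∃ λ x → ∃ λ y → P i x × P i y × ¬ (x ≈ y))
      × (∃ λ i → ∃ λ j → ∃ λ x → P i x × ¬ P j x × ∃ λ y → P j y)

-- The edges of colour c(s) join g to g s and to g s⁻¹, so a walk
-- along edges of that colour starting at x visits exactly the coset x⟨s⟩.
-- Any map f that respects equality and sends edges of colour c(s) to edges
-- of colour c(s) therefore sends x⟨s⟩ into f(x)⟨s⟩ (lemma coset-map).  A
-- colour-preserving automorphism φ and its inverse are both such maps, so
-- φ maps x⟨s⟩ onto φ(x)⟨s⟩; since "lying in the same left coset" is an
-- equivalence relation, the cosets form a partition, invariant under 𝒜ᵒ.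
--
-- For imprimitivity we need a nontrivial block: s ≠ 1 lies in ⟨s⟩ (as 1 ∉ S),
-- and we need an element outside ⟨s⟩.  Classically this is immediate from
-- ⟨s⟩ ≠ G; constructively it requires deciding membership in ⟨s⟩, which is
-- where finiteness enters: by pigeonhole s has finite order d, every integer
-- power of s is some s^r with r < d, and membership in ⟨s⟩ becomes a finite
-- search.

module Submission where

open import Defs
open import Level using (Level; Lift; lift; _⊔_)
open import Algebra.Bundles using (Group)
open import Data.Product using (_×_; ∃; _,_; proj₁; proj₂)
open import Data.Sum using (inj₁; inj₂)
open import Data.Empty using (⊥-elim)
open import Data.Nat using (ℕ; zero; suc; _+_; _∸_; _<_; z≤n; s≤s)
open import Data.Nat.Properties
  using (+-suc; n<1+n; m≤n⇒∃[o]m+o≡n; m≤n⇒m<n∨m≡n; m∸n+n≡m; <⇒≤)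
open import Data.Integer using (ℤ; +_; -[1+_])
open import Data.Fin using (Fin; toℕ; fromℕ<)
open import Data.Fin.Properties using (pigeonhole; toℕ-fromℕ<)
import Data.Fin.Properties as Fin
open import Data.List using (List; length; lookup)
open import Data.List.Relation.Unary.Any as Any using (Any; index; satisfied; any?)
open import Data.List.Relation.Unary.Any.Properties using (lookup-index)
open import Relation.Nullary using (¬_; Dec; yes; no)
open import Relation.Nullary.Decidable using (¬?; decidable-stable)
open import Function.Bundles using (Inverse; Equivalence)
open import Function.Properties.Bijection using (Bijection⇒Inverse)
open import Relation.Binary.PropositionalEquality as ≡ using (_≡_)

module Proposition {c ℓ : Level} (G : Group c ℓ) where
  open Group G
  open import Algebra.Properties.Group G
  open import Relation.Binary.Reasoning.Setoid setoid

  powℕ-+ : ∀ x m n → powℕ G x (m + n) ≈ powℕ G x m ∙ powℕ G x n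
  powℕ-+ x zero    n = sym (identityˡ _)
  powℕ-+ x (suc m) n = trans (∙-congˡ (powℕ-+ x m n)) (sym (assoc _ _ _))

  powℕ-comm : ∀ x n → powℕ G x n ∙ x ≈ x ∙ powℕ G x n
  powℕ-comm x zero    = trans (identityˡ x) (sym (identityʳ x))
  powℕ-comm x (suc n) = trans (assoc _ _ _) (∙-congˡ (powℕ-comm x n))

  powℕ-suc-⁻¹ : ∀ x n → powℕ G x (suc n) ⁻¹ ≈ powℕ G x n ⁻¹ ∙ x ⁻¹
  powℕ-suc-⁻¹ x n = ⁻¹-anti-homo-∙ x (powℕ G x n)

  powℤ-∙ʳ : ∀ x k → ∃ λ k′ → powℤ G x k ∙ x ≈ powℤ G x k′
  powℤ-∙ʳ x (+ n)            = + suc n , powℕ-comm x n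
  powℤ-∙ʳ x -[1+ zero ]      = + 0 , (begin
    (x ∙ ε) ⁻¹ ∙ x  ≈⟨ ∙-congʳ (⁻¹-cong (identityʳ x)) ⟩
    x ⁻¹ ∙ x        ≈⟨ inverseˡ x ⟩
    ε               ∎)
  powℤ-∙ʳ x -[1+ suc n ]     = -[1+ n ] , (begin
    powℕ G x (suc (suc n)) ⁻¹ ∙ x        ≈⟨ ∙-congʳ (powℕ-suc-⁻¹ x (suc n)) ⟩
    (powℕ G x (suc n) ⁻¹ ∙ x ⁻¹) ∙ x     ≈⟨ assoc _ _ _ ⟩
    powℕ G x (suc n) ⁻¹ ∙ (x ⁻¹ ∙ x)     ≈⟨ ∙-congˡ (inverseˡ x) ⟩
    powℕ G x (suc n) ⁻¹ ∙ ε              ≈⟨ identityʳ _ ⟩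
    powℕ G x (suc n) ⁻¹                  ∎)

  powℤ-∙ʳ⁻¹ : ∀ x k → ∃ λ k′ → powℤ G x k ∙ x ⁻¹ ≈ powℤ G x k′
  powℤ-∙ʳ⁻¹ x (+ zero)  = -[1+ 0 ] , trans (identityˡ _) (⁻¹-cong (sym (identityʳ x)))
  powℤ-∙ʳ⁻¹ x (+ suc n) = + n , (begin
    (x ∙ powℕ G x n) ∙ x ⁻¹  ≈⟨ ∙-congʳ (sym (powℕ-comm x n)) ⟩
    (powℕ G x n ∙ x) ∙ x ⁻¹  ≈⟨ assoc _ _ _ ⟩
    powℕ G x n ∙ (x ∙ x ⁻¹)  ≈⟨ ∙-congˡ (inverseʳ x) ⟩
    powℕ G x n ∙ ε           ≈⟨ identityʳ _ ⟩
    powℕ G x n               ∎)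
  powℤ-∙ʳ⁻¹ x -[1+ n ]  = -[1+ suc n ] , sym (powℕ-suc-⁻¹ x (suc n))

  powℤ-⁻¹ : ∀ x k → ∃ λ k′ → powℤ G x k ⁻¹ ≈ powℤ G x k′
  powℤ-⁻¹ x (+ zero)  = + 0 , ε⁻¹≈ε
  powℤ-⁻¹ x (+ suc n) = -[1+ n ] , refl
  powℤ-⁻¹ x -[1+ n ]  = + suc n , ⁻¹-involutive _

  equivalence⇒partition : ∀ {ℓR} (R : Carrier → Carrier → Set ℓR) →
    (∀ x → R x x) → (∀ {x y} → R x y → R y x) → (∀ {x y z} → R x y → R y z → R x z) →
    IsPartition G R
  equivalence⇒partition R R-refl R-sym R-trans =
    (λ i → i , R-refl i) ,
    (λ x → x , R-refl x) ,
    (λ i j (z , iz , jz) w →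
       (λ iw → R-trans (R-trans jz (R-sym iz)) iw) ,
       (λ jw → R-trans (R-trans iz (R-sym jz)) jw))

  -- Raising the universe level of the parts keeps an invariant partition
  -- invariant; needed because imprimitivity asks for parts in Set (c ⊔ ℓ).
  lift-invariantPartition : ∀ {ℓH ℓI ℓP} ℓ′ {I : Set ℓI} {H : Perm G → Set ℓH}
    {P : I → Carrier → Set ℓP} → IsInvariantPartition G H P →
    IsInvariantPartition G H (λ i z → Lift ℓ′ (P i z))
  lift-invariantPartition ℓ′ ((nonempty , covering , disjoint) , invariant) =
    ( (λ i → let (z , p) = nonempty i in z , lift p)
    , (λ x → let (i , p) = covering x in i , lift p)
    , (λ i j (z , lift p , lift q) w →
         let (i⇒j , j⇒i) = disjoint i j (z , p , q) w
         in (λ (lift r) → lift (i⇒j r)) , (λ (lift r) → lift (j⇒i r))) )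
    , λ φ hφ i → let (j , into , onto) = invariant φ hφ i in
        j , (λ z (lift p) → lift (into z p))
          , (λ w (lift q) → let (z , p , e) = onto w q in z , lift p , e)

  module Cosets (s : Carrier) where

    Coset : Carrier → Carrier → Set ℓ
    Coset = LeftCoset G s

    Edge : Carrier → Carrier → Set ℓ
    Edge = EdgeOfColor G s

    coset-respʳ : ∀ {a z w} → Coset a z → z ≈ w → Coset a w
    coset-respʳ (k , e) z≈w = k , trans (sym z≈w) e

    coset-respˡ : ∀ {a b z} → a ≈ b → Coset a z → Coset b z
    coset-respˡ a≈b (k , e) = k , trans e (∙-congʳ a≈b)

    coset-refl : ∀ a → Coset a a
    coset-refl a = + 0 , sym (identityʳ a)

    coset-sym : ∀ {a z} → Coset a z → Coset z a
    coset-sym {a} {z} (k , e) = let (k′ , inv) = powℤ-⁻¹ s k in k′ , sym (begin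
      z ∙ powℤ G s k′                ≈⟨ ∙-congˡ (sym inv) ⟩
      z ∙ powℤ G s k ⁻¹              ≈⟨ ∙-congʳ e ⟩
      (a ∙ powℤ G s k) ∙ powℤ G s k ⁻¹ ≈⟨ assoc _ _ _ ⟩
      a ∙ (powℤ G s k ∙ powℤ G s k ⁻¹) ≈⟨ ∙-congˡ (inverseʳ _) ⟩
      a ∙ ε                          ≈⟨ identityʳ a ⟩
      a                              ∎)

    coset-edge : ∀ {a z w} → Coset a z → Edge z w → Coset a w
    coset-edge {a} {z} {w} (k , e) (inj₁ w≈zs) = let (k′ , step) = powℤ-∙ʳ s k in k′ , (begin
      w                      ≈⟨ w≈zs ⟩
      z ∙ s                  ≈⟨ ∙-congʳ e ⟩
      (a ∙ powℤ G s k) ∙ s   ≈⟨ assoc _ _ _ ⟩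
      a ∙ (powℤ G s k ∙ s)   ≈⟨ ∙-congˡ step ⟩
      a ∙ powℤ G s k′        ∎)
    coset-edge {a} {z} {w} (k , e) (inj₂ w≈zs⁻¹) = let (k′ , step) = powℤ-∙ʳ⁻¹ s k in k′ , (begin
      w                       ≈⟨ w≈zs⁻¹ ⟩
      z ∙ s ⁻¹                ≈⟨ ∙-congʳ e ⟩
      (a ∙ powℤ G s k) ∙ s ⁻¹ ≈⟨ assoc _ _ _ ⟩
      a ∙ (powℤ G s k ∙ s ⁻¹) ≈⟨ ∙-congˡ step ⟩
      a ∙ powℤ G s k′         ∎)

    -- Let f respect equality and edges of colour c(s).  The points x s^k are
    -- reached from x by walks of such edges, so their images stay in every
    -- coset containing f x.
    module EdgeMap (f : Carrier → Carrier) (f-cong : ∀ {x y} → x ≈ y → f x ≈ f y)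
                   (f-edge : ∀ x y → Edge x y → Edge (f x) (f y)) where

      walk : ∀ {a x} → Coset a (f x) → ∀ k → Coset a (f (x ∙ powℤ G s k))
      walk {a} {x} h (+ n) = forward n
        where
        forward : ∀ n → Coset a (f (x ∙ powℕ G s n))
        forward zero    = coset-respʳ h (f-cong (sym (identityʳ x)))
        forward (suc n) = coset-respʳ (coset-edge (forward n) (f-edge _ _ (inj₁ refl)))
          (f-cong (trans (assoc _ _ _) (∙-congˡ (powℕ-comm s n))))
      walk {a} {x} h -[1+ n ] = backward (suc n)
        where
        backward : ∀ n → Coset a (f (x ∙ powℕ G s n ⁻¹))
        backward zero    = coset-respʳ h (f-cong (sym (trans (∙-congˡ ε⁻¹≈ε) (identityʳ x))))
        backward (suc n) = coset-respʳ (coset-edge (backward n) (f-edge _ _ (inj₂ refl)))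
          (f-cong (trans (assoc _ _ _) (∙-congˡ (sym (powℕ-suc-⁻¹ s n)))))

      coset-map : ∀ {x z} → Coset x z → Coset (f x) (f z)
      coset-map {x} (k , z≈) = coset-respʳ (walk (coset-refl (f x)) k) (f-cong (sym z≈))

    coset-trans : ∀ {a b z} → Coset a b → Coset b z → Coset a z
    coset-trans h (k , z≈) = coset-respʳ (EdgeMap.walk (λ x → x) (λ e → e) (λ _ _ e → e) h k) (sym z≈)

    -- First half of the proposition: the left cosets of ⟨s⟩ are blocks of 𝒜ᵒ.
    -- Both φ and φ⁻¹ preserve colour c(s), so φ maps i⟨s⟩ onto φ(i)⟨s⟩.
    cosets-invariant : ∀ {ℓS} (S : Carrier → Set ℓS) → S s →
      IsInvariantPartition G (IsColorPreservingAut G S) Coset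
    cosets-invariant S Ss =
      equivalence⇒partition Coset coset-refl coset-sym coset-trans , invariant
      where
      invariant : ∀ φ → IsColorPreservingAut G S φ → ∀ i → ∃ λ j → MapsOnto G φ (Coset i) (Coset j)
      invariant φ hφ i = to i , (λ _ → To.coset-map) , onto
        where
        open Inverse (Bijection⇒Inverse φ)
        preserves = hφ s Ss
        module To = EdgeMap to to-cong (λ x y → Equivalence.to (preserves x y))
        from-edge : ∀ x y → Edge x y → Edge (from x) (from y)
        from-edge x y e = Equivalence.from (preserves (from x) (from y))
          (edge-cong (strictlyInverseˡ x) (strictlyInverseˡ y) e)
          where
          edge-cong : ∀ {x x′ y y′} → x′ ≈ x → y′ ≈ y → Edge x y → Edge x′ y′
          edge-cong x′≈x y′≈y (inj₁ e) = inj₁ (trans y′≈y (trans e (∙-congʳ (sym x′≈x))))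
          edge-cong x′≈x y′≈y (inj₂ e) = inj₂ (trans y′≈y (trans e (∙-congʳ (sym x′≈x))))
        module From = EdgeMap from from-cong from-edge
        onto : ∀ w → Coset (to i) w → ∃ λ z → Coset i z × to z ≈ w
        onto w h = from w , coset-respˡ (strictlyInverseʳ i) (From.coset-map h) , strictlyInverseˡ w

  module Finite (_≟_ : ∀ x y → Dec (x ≈ y)) (xs : List Carrier)
                (cover : ∀ x → Any (x ≈_) xs) where

    counterexample : ∀ {ℓP} {P : Carrier → Set ℓP} → (∀ x → Dec (P x)) →
      (∀ {x y} → x ≈ y → P x → P y) → ¬ (∀ x → P x) → ∃ λ x → ¬ P x
    counterexample {P = P} P? P-resp notAll with any? (λ y → ¬? (P? y)) xs
    ... | yes found = satisfied found
    ... | no none = ⊥-elim (notAll λ x → decidable-stable (P? x) λ ¬Px →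
            none (Any.map (λ x≈y Py → ¬Px (P-resp (sym x≈y) Py)) (cover x)))

    module Order (s : Carrier) where

      -- Pigeonhole on s⁰,…,s^|xs| gives s^i ≈ s^j with i < j, whence
      -- s^(j-i) ≈ ε: s has finite order.
      finite-order : ∃ λ d → powℕ G s (suc d) ≈ ε
      finite-order with pigeonhole (n<1+n (length xs)) (λ r → index (cover (powℕ G s (toℕ r))))
      ... | i , j , i<j , same-index with m≤n⇒∃[o]m+o≡n i<j
      ... | o , i+1+o≡j = o , identityʳ-unique (powℕ G s (toℕ i)) _ (begin
        powℕ G s (toℕ i) ∙ powℕ G s (suc o) ≈⟨ powℕ-+ s (toℕ i) (suc o) ⟨
        powℕ G s (toℕ i + suc o)           ≡⟨ ≡.cong (powℕ G s) (≡.trans (+-suc (toℕ i) o) i+1+o≡j) ⟩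
        powℕ G s (toℕ j)                   ≈⟨ lookup-index (cover _) ⟩
        lookup xs (index (cover _))        ≡⟨ ≡.cong (lookup xs) same-index ⟨
        lookup xs (index (cover _))        ≈⟨ lookup-index (cover _) ⟨
        powℕ G s (toℕ i)                   ∎)

      d : ℕ
      d = suc (proj₁ finite-order)

      powℕ-d : powℕ G s d ≈ ε
      powℕ-d = proj₂ finite-order

      powℕ-reduce : ∀ n → ∃ λ r → r < d × powℕ G s n ≈ powℕ G s r
      powℕ-reduce zero    = 0 , s≤s z≤n , refl
      powℕ-reduce (suc n) with powℕ-reduce n
      ... | r , r<d , e with m≤n⇒m<n∨m≡n r<d
      ... | inj₁ r+1<d = suc r , r+1<d , ∙-congˡ e
      ... | inj₂ r+1≡d = 0 , s≤s z≤n ,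
            trans (∙-congˡ e) (trans (reflexive (≡.cong (powℕ G s) r+1≡d)) powℕ-d)

      powℕ-inverse : ∀ {r} → r < d → powℕ G s r ⁻¹ ≈ powℕ G s (d ∸ r)
      powℕ-inverse {r} r<d = sym (inverseˡ-unique _ _ (begin
        powℕ G s (d ∸ r) ∙ powℕ G s r ≈⟨ powℕ-+ s (d ∸ r) r ⟨
        powℕ G s (d ∸ r + r)          ≡⟨ ≡.cong (powℕ G s) (m∸n+n≡m (<⇒≤ r<d)) ⟩
        powℕ G s d                    ≈⟨ powℕ-d ⟩
        ε                             ∎))

      powℤ-bounded : ∀ k → ∃ λ (r : Fin d) → powℤ G s k ≈ powℕ G s (toℕ r)
      powℤ-bounded (+ n) =
        let (r , r<d , e) = powℕ-reduce n
        in fromℕ< r<d , trans e (reflexive (≡.cong (powℕ G s) (≡.sym (toℕ-fromℕ< r<d))))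
      powℤ-bounded -[1+ n ] =
        let (r , r<d , e) = powℕ-reduce (suc n)
            (r′ , r′<d , e′) = powℕ-reduce (d ∸ r)
        in fromℕ< r′<d , (begin
          powℕ G s (suc n) ⁻¹        ≈⟨ ⁻¹-cong e ⟩
          powℕ G s r ⁻¹              ≈⟨ powℕ-inverse r<d ⟩
          powℕ G s (d ∸ r)           ≈⟨ e′ ⟩
          powℕ G s r′                ≡⟨ ≡.cong (powℕ G s) (toℕ-fromℕ< r′<d) ⟨
          powℕ G s (toℕ (fromℕ< r′<d)) ∎)

      ⟨s⟩? : ∀ g → Dec (⟨_⟩ G s g)
      ⟨s⟩? g with Fin.any? (λ r → g ≟ powℕ G s (toℕ r))
      ... | yes (r , e) = yes (+ toℕ r , e)
      ... | no none = no λ (k , e) → let (r , e′) = powℤ-bounded k in none (r , trans e e′)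

proposition1p7 : {c ℓ ℓS : Level} (G : Group c ℓ) → IsFiniteGroup G →
    let open Group G in
    (S : Carrier → Set ℓS) → (∀ {x y} → x ≈ y → S x → S y) →
    ¬ S ε → (∀ s → S s → S (s ⁻¹)) →
    (∀ s → S s → ¬ (s ≈ ε) →
    IsInvariantPartition G (IsColorPreservingAut G S) (LeftCoset G s))
    × ((∃ λ s → S s × ¬ (∀ g → ⟨_⟩ G s g) × ¬ (∀ g → ⟨_⟩ G s g → g ≈ ε)) →
    IsImprimitive G (IsColorPreservingAut G S))
proposition1p7 {c} {ℓ} G (_≟_ , xs , cover) S S-resp ¬Sε _ =
  (λ s Ss _ → Cosets.cosets-invariant s S Ss) , imprimitive
  where
  open Group G
  open Proposition G
  open Finite _≟_ xs cover

  -- The block ⟨s⟩ contains ε and s ≠ ε; the block through an element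
  -- j ∉ ⟨s⟩ is a different block.
  imprimitive : (∃ λ s → S s × ¬ (∀ g → ⟨_⟩ G s g) × ¬ (∀ g → ⟨_⟩ G s g → g ≈ ε)) →
                IsImprimitive G (IsColorPreservingAut G S)
  imprimitive (s , Ss , ⟨s⟩≠G , _) =
    Block , lift-invariantPartition c (cosets-invariant S Ss) ,
    (ε , ε , s , lift (coset-refl ε) , lift s∈⟨s⟩ , λ ε≈s → ¬Sε (S-resp (sym ε≈s) Ss)) ,
    (ε , j , ε , lift (coset-refl ε) , (λ (lift ε∈j⟨s⟩) → j∉⟨s⟩ (in-⟨s⟩ (coset-sym ε∈j⟨s⟩))) ,
     j , lift (coset-refl j))
    where
    open Cosets s
    Block : Carrier → Carrier → Set (c ⊔ ℓ)
    Block i z = Lift c (Coset i z)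
    s∈⟨s⟩ : Coset ε s
    s∈⟨s⟩ = + 1 , sym (trans (identityˡ _) (identityʳ s))
    in-⟨s⟩ : ∀ {g} → Coset ε g → ⟨_⟩ G s g
    in-⟨s⟩ (k , e) = k , trans e (identityˡ _)
    outside = counterexample (Order.⟨s⟩? s) (λ x≈y (k , e) → k , trans (sym x≈y) e) ⟨s⟩≠G
    j = proj₁ outside
    j∉⟨s⟩ = proj₂ outside
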